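{- Let $G$ be a plane graph without $4$-cycles and without $8$-cycles with $\delta(G)\ge 3$. Let $v$ be a vertex of degree $3$ incident with a $3$-face $f_1=[vv_1v_2]$, a $5$-face $f_2=[vv_2v_3v_4v_5]$ and a $6$-face $f_3=[vv_5v_6v_7v_8v_1]$. Then: (1) $v_4$ and $v_7$ are the same vertex, and $f_2$ is adjacent to exactly one $3$-face, namely $f_1$; (2) no vertex on the boundary of $f_2$ or of $f_3$ other than $v$ is a special $3$-vertex.
   Context: Graphs are finite and simple; a plane graph is a planar graph with a fixed embedding. A $k$-face is a face whose boundary walk has length $k$; $f=[u_1u_2\dots u_d]$ denotes a face with boundary vertices $u_1,\dots,u_d$ in cyclic order. A $3$-vertex is a vertex of degree $3$. Two faces are adjacent if their boundaries share at least one edge. A $3$-vertex is special if it is incident with a $3$-face, a $5$-face and a $6$-face. -}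

module Defs where

open import Data.Nat using (ℕ; zero; suc; _+_; _*_; _≤_; _<_)
open import Data.Nat.DivMod using (_mod_)
open import Data.Fin using (Fin)
open import Data.Bool using (Bool; true; false; T; if_then_else_)
open import Data.List using (List; map; allFin)
open import Data.Nat.ListAction using (sum)
open import Data.Vec using (Vec; lookup)
open import Data.Product using (Σ; ∃; ∃₂; _×_; _,_; proj₁; proj₂)
open import Data.Sum using (_⊎_)
open import Relation.Nullary using (¬_)
open import Relation.Binary.PropositionalEquality using (_≡_)
open import Relation.Binary.Construct.Closure.ReflexiveTransitive using (Star)

iter : ∀ {A : Set} → (A → A) → ℕ → A → A
iter f zero    x = x
iter f (suc k) x = f (iter f k x)

NumClasses : (A : Set) → (A → A → Set) → ℕ → Set
NumClasses A R k =
  Σ (A → Fin k) λ f →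
    (∀ j → ∃ λ x → f x ≡ j) ×
    (∀ x y → (R x y → f x ≡ f y) × (f x ≡ f y → R x y))

Card : Set → ℕ → Set
Card A k = NumClasses A _≡_ k

-- Simple graphs on vertex set Fin n with a rotation system
-- (a cyclic order of the neighbours around each vertex), i.e. a
-- combinatorial embedding on an orientable surface.

record RotationSystem (n : ℕ) : Set where
  field
    adj      : Fin n → Fin n → Bool
    adj-sym  : ∀ u w → adj u w ≡ adj w u
    adj-irr  : ∀ u → adj u u ≡ false
    -- rot v : successor of a neighbour of v in the cyclic order around v
    rot      : Fin n → Fin n → Fin n
    rot-adj  : ∀ v w → T (adj v w) → T (adj v (rot v w))
    rot-inj  : ∀ v w w' → T (adj v w) → T (adj v w') →
               rot v w ≡ rot v w' → w ≡ w'
    rot-cyc  : ∀ v w w' → T (adj v w) → T (adj v w') →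
               ∃ λ k → iter (rot v) k w ≡ w'

module _ {n : ℕ} (G : RotationSystem n) where
  open RotationSystem G

  Adj : Fin n → Fin n → Set
  Adj u w = T (adj u w)

  Dart : Set
  Dart = Σ (Fin n × Fin n) λ p → Adj (proj₁ p) (proj₂ p)

  -- face-tracing permutation: after traversing u→w, continue along
  -- the edge w→(successor of u around w)
  φ : Fin n × Fin n → Fin n × Fin n
  φ (u , w) = (w , rot w u)

  SameFaceDart : Dart → Dart → Set
  SameFaceDart d d' = ∃ λ k → iter φ k (proj₁ d) ≡ proj₁ d'

  Reach : Fin n → Fin n → Set
  Reach = Star Adj

  Isolated : Set
  Isolated = Σ (Fin n) λ v → ∀ w → adj v w ≡ false

  -- Euler's formula V - E + F = 2C (darts = 2E; every isolated vertex
  -- contributes one face), which holds iff every component is embedded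
  -- in the sphere (genus 0).
  Spherical : Set
  Spherical = Σ ℕ λ D → Σ ℕ λ F → Σ ℕ λ I → Σ ℕ λ C →
    Card Dart D × NumClasses Dart SameFaceDart F × Card Isolated I ×
    NumClasses (Fin n) Reach C ×
    (2 * (n + F + I) ≡ D + 4 * C)

record PlaneGraph (n : ℕ) : Set where
  field
    rs     : RotationSystem n
    planar : Spherical rs
  open RotationSystem rs public

module _ {n : ℕ} (G : PlaneGraph n) where
  open PlaneGraph G

  Adjacent : Fin n → Fin n → Set
  Adjacent = Adj rs

  deg : Fin n → ℕ
  deg v = sum (map (λ w → if adj v w then 1 else 0) (allFin n))

  HasCycle : ℕ → Set
  HasCycle k = Σ (ℕ → Fin n) λ c →
    (∀ i → c (k + i) ≡ c i) ×
    (∀ i j → i < k → j < k → c i ≡ c j → i ≡ j) ×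
    (∀ i → Adjacent (c i) (c (suc i)))

  -- w (as a d-periodic sequence w 0, w 1, ...) is the boundary walk of a
  -- face of length exactly d: consecutive darts follow the face-tracing
  -- permutation, and the orbit of the dart (w 0 , w 1) has size d.
  IsFace : ℕ → (ℕ → Fin n) → Set
  IsFace d w =
    (∀ i → Adjacent (w i) (w (suc i))) ×
    (∀ i → rot (w (suc i)) (w i) ≡ w (suc (suc i))) ×
    (w d ≡ w 0 × w (suc d) ≡ w 1) ×
    (∀ k → 0 < k → k < d → ¬ (w k ≡ w 0 × w (suc k) ≡ w 1))

  SameFace : (ℕ → Fin n) → (ℕ → Fin n) → Set
  SameFace w w' = ∃ λ k → w k ≡ w' 0 × w (suc k) ≡ w' 1

  FacesAdjacent : (ℕ → Fin n) → (ℕ → Fin n) → Set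
  FacesAdjacent w w' = ∃₂ λ i j →
    (w i ≡ w' j × w (suc i) ≡ w' (suc j)) ⊎
    (w i ≡ w' (suc j) × w (suc i) ≡ w' j)

  OnFace : Fin n → (ℕ → Fin n) → Set
  OnFace u w = ∃ λ i → w i ≡ u

  Special : Fin n → Set
  Special u = deg u ≡ 3 ×
    (∃ λ w → IsFace 3 w × OnFace u w) ×
    (∃ λ w → IsFace 5 w × OnFace u w) ×
    (∃ λ w → IsFace 6 w × OnFace u w)

walk : ∀ {n d} → Vec (Fin n) (suc d) → ℕ → Fin n
walk {d = d} us i = lookup us (i mod suc d)

{-# OPTIONS --safe #-}
-- Everything is read off the rotation system. Since every degree is at least 3, no rotation has
-- a fixed point or a 2-cycle, the rotation at a vertex of degree 3 is a 3-cycle, no facial walk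
-- backtracks, and two faces sharing a dart have the same length. As v has degree 3 and G has no
-- 4-cycles, the vertices v, v₁, …, v₈ satisfy many non-adjacencies and inequalities; with v₇ ≠ v₄
-- they would make v₁ v₂ … v₈ an 8-cycle. Once v₇ = v₄, the vertex v₄ has four neighbours, and at
-- every other vertex of f₂ or f₃ except v a 3-, 5- or 6-face, as well as a 3-face on a reversed edge
-- of f₂ other than v₂v, would close a 4- or 8-cycle, repeat a dart of f₁, f₂ or f₃, or give some
-- rotation a 2-cycle.
module Submission where

open import Defs
open import Data.Nat using (ℕ; zero; suc; _+_; _*_; _≤_; _<_; z≤n; s≤s; _%_; _/_; NonZero)
open import Data.Nat.Properties using (≤-trans; +-comm; +-assoc; +-suc; +-identityʳ; <-cmp)
open import Data.Nat.DivMod using (_mod_; m≡m%n+[m/n]*n; m%n%n≡m%n; %-distribˡ-+; [m+n]%n≡m%n; m<n⇒m%n≡m; m%n<n)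
open import Data.Fin using (Fin; zero; suc; toℕ; _≟_)
open import Data.Fin.Properties using (fromℕ<-cong; toℕ-fromℕ<; injective⇒≤)
open import Data.Bool using (Bool; true; false; T; if_then_else_)
open import Data.List using (List; []; _∷_; length; map; allFin; filterᵇ; lookup)
open import Data.List.Membership.Propositional using () renaming (_∈_ to _∈ₗ_)
open import Data.List.Membership.Propositional.Properties using (∈-lookup; ∈-filter⁺; ∈-filter⁻; ∈-allFin)
open import Data.List.Relation.Unary.Any using (here; there; index)
open import Data.List.Relation.Unary.Any.Properties using (lookup-index)
open import Data.List.Relation.Unary.All as All using ([]; _∷_)
open import Data.List.Relation.Unary.AllPairs using ([]; _∷_)
open import Data.Vec.Relation.Unary.AllPairs using ([]; _∷_)
open import Data.Vec.Relation.Unary.All using ([]; _∷_)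
open import Data.Vec.Relation.Unary.Any using (here; there)
open import Data.List.Relation.Unary.Unique.Propositional using () renaming (Unique to Uniqueₗ)
open import Data.List.Relation.Unary.Unique.Propositional.Properties using (allFin⁺; filter⁺)
open import Data.Nat.ListAction using (sum)
open import Data.Vec as Vec using (Vec; []; _∷_; tabulate)
open import Data.Vec.Properties using (lookup∘tabulate)
open import Data.Vec.Membership.Propositional using (_∈_)
open import Data.Vec.Membership.Propositional.Properties using () renaming (∈-lookup to ∈-lookupᵥ)
open import Data.Vec.Relation.Unary.Unique.Propositional using (Unique)
open import Data.Vec.Relation.Unary.Unique.Propositional.Properties using (lookup-injective)
open import Data.Product using (Σ; _×_; _,_; proj₁; proj₂)
open import Data.Sum using (_⊎_; inj₁; inj₂)
open import Data.Empty using (⊥; ⊥-elim)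
open import Function using (_∘_)
open import Relation.Nullary using (¬_; yes; no)
open import Relation.Nullary.Decidable using (T?)
open import Relation.Binary.PropositionalEquality
open import Relation.Binary.Definitions using (tri<; tri≈; tri>)

module _ {A : Set} where

  lookup-injectiveₗ : {xs : List A} → Uniqueₗ xs → ∀ i j → lookup xs i ≡ lookup xs j → i ≡ j
  lookup-injectiveₗ (_ ∷ _) zero zero _ = refl
  lookup-injectiveₗ (x∉ ∷ _) zero (suc j) e = ⊥-elim (All.lookup x∉ (∈-lookup j) e)
  lookup-injectiveₗ (x∉ ∷ _) (suc i) zero e = ⊥-elim (All.lookup x∉ (∈-lookup i) (sym e))
  lookup-injectiveₗ (_ ∷ u) (suc i) (suc j) e = cong suc (lookup-injectiveₗ u i j e)

  unique-⊆⇒length≤ : {xs ys : List A} → Uniqueₗ xs → (∀ {x} → x ∈ₗ xs → x ∈ₗ ys) → length xs ≤ length ys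
  unique-⊆⇒length≤ {xs} {ys} u xs⊆ys = injective⇒≤ {f = position} position-injective
    where
    position : Fin (length xs) → Fin (length ys)
    position i = index (xs⊆ys (∈-lookup i))
    position-injective : ∀ {i j} → position i ≡ position j → i ≡ j
    position-injective {i} {j} e = lookup-injectiveₗ u i j (begin
      lookup xs i                    ≡⟨ lookup-index (xs⊆ys (∈-lookup i)) ⟩
      lookup ys (position i)         ≡⟨ cong (lookup ys) e ⟩
      lookup ys (position j)         ≡⟨ lookup-index (xs⊆ys (∈-lookup j)) ⟨
      lookup xs j                    ∎)
      where open ≡-Reasoning

module _ {n d : ℕ} (us : Vec (Fin n) (suc d)) where

  walk-cong : ∀ i j → i % suc d ≡ j % suc d → walk us i ≡ walk us j
  walk-cong i j e = cong (Vec.lookup us) (fromℕ<-cong _ _ e _ _)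

  walk-mod : ∀ i → walk us i ≡ walk us (i % suc d)
  walk-mod i = walk-cong i (i % suc d) (sym (m%n%n≡m%n i (suc d)))

  walk-periodic : ∀ i → walk us (suc d + i) ≡ walk us i
  walk-periodic i = walk-cong (suc d + i) i (trans (cong (_% suc d) (+-comm (suc d) i)) ([m+n]%n≡m%n i (suc d)))

  walk-suc-mod : ∀ i → walk us (suc i) ≡ walk us (suc (i % suc d))
  walk-suc-mod i = walk-cong (suc i) (suc (i % suc d)) (trans (%-distribˡ-+ 1 i (suc d))
    (sym (trans (%-distribˡ-+ 1 (i % suc d) (suc d)) (cong (λ t → (1 % suc d + t) % suc d) (m%n%n≡m%n i (suc d))))))

  walk-∈ : ∀ i → walk us i ∈ us
  walk-∈ i = ∈-lookupᵥ _ us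

  walk-edges : (P : Fin n → Fin n → Set) → (∀ k → k < suc d → P (walk us k) (walk us (suc k))) →
               ∀ i → P (walk us i) (walk us (suc i))
  walk-edges P edge i = subst₂ P (sym (walk-mod i)) (sym (walk-suc-mod i)) (edge (i % suc d) (m%n<n i (suc d)))

  walk-injective : Unique us → ∀ {i j} → i < suc d → j < suc d → walk us i ≡ walk us j → i ≡ j
  walk-injective u {i} {j} i<m j<m e = begin
    i                ≡⟨ m<n⇒m%n≡m i<m ⟨
    i % suc d        ≡⟨ toℕ-fromℕ< (m%n<n i (suc d)) ⟨
    toℕ (i mod suc d) ≡⟨ cong toℕ (lookup-injective u _ _ e) ⟩
    toℕ (j mod suc d) ≡⟨ toℕ-fromℕ< (m%n<n j (suc d)) ⟩
    j % suc d        ≡⟨ m<n⇒m%n≡m j<m ⟩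
    j                ∎
    where open ≡-Reasoning

ones≡length-filterᵇ : {A : Set} (b : A → Bool) (xs : List A) →
                      sum (map (λ x → if b x then 1 else 0) xs) ≡ length (filterᵇ b xs)
ones≡length-filterᵇ b [] = refl
ones≡length-filterᵇ b (x ∷ xs) with b x
... | true  = cong suc (ones≡length-filterᵇ b xs)
... | false = ones≡length-filterᵇ b xs

periodic-mod : {A : Set} {f : ℕ → A} (m : ℕ) .{{_ : NonZero m}} → (∀ k → f (m + k) ≡ f k) → ∀ k → f k ≡ f (k % m)
periodic-mod {f = f} m periodic k = begin
  f k                       ≡⟨ cong f (m≡m%n+[m/n]*n k m) ⟩
  f (k % m + (k / m) * m)   ≡⟨ cong f (+-comm (k % m) _) ⟩
  f ((k / m) * m + k % m)   ≡⟨ multiple (k / m) (k % m) ⟩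
  f (k % m)                 ∎
  where
  open ≡-Reasoning
  multiple : ∀ q r → f (q * m + r) ≡ f r
  multiple zero    r = refl
  multiple (suc q) r = trans (cong f (+-assoc m (q * m) r)) (trans (periodic (q * m + r)) (multiple q r))

module Embedding {n : ℕ} (G : PlaneGraph n) where
  open PlaneGraph G

  infix 4 _~_
  _~_ : Fin n → Fin n → Set
  _~_ = Adjacent G

  ~-sym : ∀ {u w} → u ~ w → w ~ u
  ~-sym {u} {w} = subst T (adj-sym u w)

  ~⇒≢ : ∀ {u w} → u ~ w → u ≢ w
  ~⇒≢ {u} u~u refl = subst T (adj-irr u) u~u

  ≁-sym : ∀ {x y} → ¬ x ~ y → ¬ y ~ x
  ≁-sym x≁y = x≁y ∘ ~-sym

  ~∧≁⇒≢ : ∀ {x y z} → z ~ x → ¬ z ~ y → x ≢ y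
  ~∧≁⇒≢ zx z≁y refl = z≁y zx

  neighbours : Fin n → List (Fin n)
  neighbours u = filterᵇ (adj u) (allFin n)

  deg≡length-neighbours : ∀ u → deg G u ≡ length (neighbours u)
  deg≡length-neighbours u = ones≡length-filterᵇ (adj u) (allFin n)

  deg≤length : ∀ {u} {ys : List (Fin n)} → (∀ {w} → u ~ w → w ∈ₗ ys) → deg G u ≤ length ys
  deg≤length {u} ⊆ys = subst (_≤ _) (sym (deg≡length-neighbours u))
    (unique-⊆⇒length≤ (filter⁺ _ (allFin⁺ n)) (λ w∈N → ⊆ys (proj₂ (∈-filter⁻ (T? ∘ adj u) {xs = allFin n} w∈N))))

  length≤deg : ∀ {u} {xs : List (Fin n)} → Uniqueₗ xs → (∀ {w} → w ∈ₗ xs → u ~ w) → length xs ≤ deg G u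
  length≤deg {u} uxs ~u = subst (_ ≤_) (sym (deg≡length-neighbours u))
    (unique-⊆⇒length≤ uxs (λ w∈xs → ∈-filter⁺ (T? ∘ adj u) (∈-allFin _) (~u w∈xs)))

  rot-closed⇒neighbours-⊆ : ∀ {u a} {L : List (Fin n)} → u ~ a → a ∈ₗ L → (∀ {x} → x ∈ₗ L → rot u x ∈ₗ L) →
                             ∀ {w} → u ~ w → w ∈ₗ L
  rot-closed⇒neighbours-⊆ {u} {a} {L} u~a a∈L closed {w} u~w with rot-cyc u a w u~a u~w
  ... | k , rotᵏa≡w = subst (_∈ₗ L) rotᵏa≡w (iterate k)
    where
    iterate : ∀ k → iter (rot u) k a ∈ₗ L
    iterate zero    = a∈L
    iterate (suc k) = closed (iterate k)

  rot-fixed⇒deg≤1 : ∀ {u a} → u ~ a → rot u a ≡ a → deg G u ≤ 1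
  rot-fixed⇒deg≤1 u~a fixed = deg≤length (rot-closed⇒neighbours-⊆ {L = _ ∷ []} u~a (here refl)
    λ { (here refl) → here fixed ; (there ()) })

  rot-involutive⇒deg≤2 : ∀ {u a b} → u ~ a → rot u a ≡ b → rot u b ≡ a → deg G u ≤ 2
  rot-involutive⇒deg≤2 u~a a↦b b↦a = deg≤length (rot-closed⇒neighbours-⊆ {L = _ ∷ _ ∷ []} u~a (here refl)
    λ { (here refl) → there (here a↦b) ; (there (here refl)) → here b↦a ; (there (there ())) })

  cycle : ∀ {d} (us : Vec (Fin n) (suc d)) → Unique us →
          (∀ k → k < suc d → walk us k ~ walk us (suc k)) → HasCycle G (suc d)
  cycle us distinct edge = walk us , walk-periodic us , (λ i j → walk-injective us distinct) , walk-edges us _~_ edge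

  4≤deg : ∀ {u a b c d} → u ~ a → u ~ b → u ~ c → u ~ d → Uniqueₗ (a ∷ b ∷ c ∷ d ∷ []) → 4 ≤ deg G u
  4≤deg ua ub uc ud distinct = length≤deg distinct λ
    { (here refl) → ua ; (there (here refl)) → ub ; (there (there (here refl))) → uc
    ; (there (there (there (here refl)))) → ud ; (there (there (there (there ())))) }

  deg≡3⇒4≰deg : ∀ {u} → deg G u ≡ 3 → ¬ 4 ≤ deg G u
  deg≡3⇒4≰deg d≡3 4≤d with subst (4 ≤_) d≡3 4≤d
  ... | s≤s (s≤s (s≤s ()))

  neighbours-of-deg≡3 : ∀ {u a b c y} → deg G u ≡ 3 → u ~ a → u ~ b → u ~ c →
                        a ≢ b → a ≢ c → b ≢ c → u ~ y → y ≡ a ⊎ y ≡ b ⊎ y ≡ c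
  neighbours-of-deg≡3 {y = y} d≡3 ua ub uc a≢b a≢c b≢c uy with y ≟ _ | y ≟ _ | y ≟ _
  ... | yes y≡a | _        | _        = inj₁ y≡a
  ... | no _    | yes y≡b  | _        = inj₂ (inj₁ y≡b)
  ... | no _    | no _     | yes y≡c  = inj₂ (inj₂ y≡c)
  ... | no y≢a  | no y≢b   | no y≢c   = ⊥-elim (deg≡3⇒4≰deg d≡3 (4≤deg uy ua ub uc
          ((y≢a ∷ y≢b ∷ y≢c ∷ []) ∷ (a≢b ∷ a≢c ∷ []) ∷ (b≢c ∷ []) ∷ [] ∷ [])))

  NoCommonNeighbour : Fin n → Fin n → Set
  NoCommonNeighbour u w = ∀ {x} → x ~ u → x ~ w → ⊥

  -- The corners p, q of such a triangle differ from a and b, giving u four distinct neighbours.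
  deg≡3-triangle-free : ∀ {u a b p q} → deg G u ≡ 3 → u ~ a → u ~ b → a ≢ b →
                        NoCommonNeighbour u a → NoCommonNeighbour u b → u ~ p → u ~ q → ¬ p ~ q
  deg≡3-triangle-free d≡3 ua ub a≢b free-a free-b up uq pq = deg≡3⇒4≰deg d≡3 (4≤deg up uq ua ub
      ((~⇒≢ pq ∷ p≢ free-a ∷ p≢ free-b ∷ []) ∷ (q≢ free-a ∷ q≢ free-b ∷ []) ∷ (a≢b ∷ []) ∷ [] ∷ []))
    where
    p≢ : ∀ {c} → NoCommonNeighbour _ c → _ ≢ c
    p≢ free refl = free (~-sym uq) (~-sym pq)
    q≢ : ∀ {c} → NoCommonNeighbour _ c → _ ≢ c
    q≢ free refl = free (~-sym up) pq

  4-cycle : ∀ {a b c d} → a ~ b → b ~ c → c ~ d → d ~ a → a ≢ c → b ≢ d → HasCycle G 4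
  4-cycle ab bc cd da a≢c b≢d = cycle (_ ∷ _ ∷ _ ∷ _ ∷ [])
    ((~⇒≢ ab ∷ a≢c ∷ ≢-sym (~⇒≢ da) ∷ []) ∷ (~⇒≢ bc ∷ b≢d ∷ []) ∷ (~⇒≢ cd ∷ []) ∷ [] ∷ [])
    λ { 0 _ → ab ; 1 _ → bc ; 2 _ → cd ; 3 _ → da ; (suc (suc (suc (suc _)))) (s≤s (s≤s (s≤s (s≤s ())))) }

  8-cycle : ∀ {x₀ x₁ x₂ x₃ x₄ x₅ x₆ x₇} →
            x₀ ~ x₁ → x₁ ~ x₂ → x₂ ~ x₃ → x₃ ~ x₄ → x₄ ~ x₅ → x₅ ~ x₆ → x₆ ~ x₇ → x₇ ~ x₀ →
            Unique (x₀ ∷ x₁ ∷ x₂ ∷ x₃ ∷ x₄ ∷ x₅ ∷ x₆ ∷ x₇ ∷ []) → HasCycle G 8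
  8-cycle e₀ e₁ e₂ e₃ e₄ e₅ e₆ e₇ distinct = cycle (_ ∷ _ ∷ _ ∷ _ ∷ _ ∷ _ ∷ _ ∷ _ ∷ []) distinct λ
    { 0 _ → e₀ ; 1 _ → e₁ ; 2 _ → e₂ ; 3 _ → e₃ ; 4 _ → e₄ ; 5 _ → e₅ ; 6 _ → e₆ ; 7 _ → e₇
    ; (suc (suc (suc (suc (suc (suc (suc (suc _)))))))) (s≤s (s≤s (s≤s (s≤s (s≤s (s≤s (s≤s (s≤s ())))))))) }

  -- A facial walk arriving at y from x leaves y towards z.
  _↝_↝_ : Fin n → Fin n → Fin n → Set
  x ↝ y ↝ z = rot y x ≡ z

  FollowsRotation : (ℕ → Fin n) → Set
  FollowsRotation w = ∀ i → w i ↝ w (suc i) ↝ w (suc (suc i))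

  rotation-walks-agree : ∀ {w w'} → FollowsRotation w → FollowsRotation w' →
                         ∀ {a b} → w a ≡ w' b → w (suc a) ≡ w' (suc b) →
                         ∀ k → w (k + a) ≡ w' (k + b) × w (suc (k + a)) ≡ w' (suc (k + b))
  rotation-walks-agree r r' e₀ e₁ zero = e₀ , e₁
  rotation-walks-agree r r' {a} {b} e₀ e₁ (suc k) with rotation-walks-agree r r' e₀ e₁ k
  ... | eₖ , eₖ₊₁ = eₖ₊₁ , trans (sym (r (k + a))) (trans (cong₂ rot eₖ₊₁ eₖ) (r' (k + b)))

  -- rot is injective around each vertex, so a walk following the rotation can also be run backwards.
  rotation-walk-unshift : ∀ {w} → (∀ i → w i ~ w (suc i)) → FollowsRotation w →
                          ∀ m p → w (p + m) ≡ w m → w (suc (p + m)) ≡ w (suc m) →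
                          w p ≡ w 0 × w (suc p) ≡ w 1
  rotation-walk-unshift {w} edge r zero p e₀ e₁ =
    trans (cong w (sym (+-identityʳ p))) e₀ , trans (cong (w ∘ suc) (sym (+-identityʳ p))) e₁
  rotation-walk-unshift {w} edge r (suc m) p e₀ e₁ = rotation-walk-unshift edge r m p eₘ e₀'
    where
    e₀' : w (suc (p + m)) ≡ w (suc m)
    e₀' = trans (cong w (sym (+-suc p m))) e₀
    eₘ : w (p + m) ≡ w m
    eₘ = rot-inj (w (suc m)) (w (p + m)) (w m)
           (subst (_~ w (p + m)) e₀' (~-sym (edge (p + m)))) (~-sym (edge m))
           (begin
             rot (w (suc m)) (w (p + m))        ≡⟨ cong (λ x → rot x (w (p + m))) e₀' ⟨
             rot (w (suc (p + m))) (w (p + m))  ≡⟨ r (p + m) ⟩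
             w (suc (suc (p + m)))              ≡⟨ cong (w ∘ suc) (sym (+-suc p m)) ⟩
             w (suc (p + suc m))                ≡⟨ e₁ ⟩
             w (suc (suc m))                    ≡⟨ r m ⟨
             rot (w (suc m)) (w m)              ∎)
      where open ≡-Reasoning

  face-edge : ∀ {d w} → IsFace G d w → ∀ i → w i ~ w (suc i)
  face-edge = proj₁

  face-turn : ∀ {d w} → IsFace G d w → FollowsRotation w
  face-turn = proj₁ ∘ proj₂

  face-periodic : ∀ {d w} → IsFace G d w → ∀ k → w (d + k) ≡ w k
  face-periodic {d} {w} (_ , r , (closes₀ , closes₁) , _) k =
    trans (cong w (+-comm d k)) (trans (proj₁ (rotation-walks-agree r r closes₀ closes₁ k)) (cong w (+-identityʳ k)))

  face-rotate : ∀ {d w} → IsFace G d w → ∀ i → IsFace G d (λ k → w (k + i))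
  face-rotate {d} {w} F@(edge , r , _ , minimal) i =
      (λ k → edge (k + i))
    , (λ k → r (k + i))
    , (face-periodic F i , trans (cong w (sym (+-suc d i))) (face-periodic F (suc i)))
    , λ k 0<k k<d (eₖ , eₖ₊₁) → minimal k 0<k k<d (rotation-walk-unshift edge r i k eₖ eₖ₊₁)

  shorter-face-shares-no-dart : ∀ {d d' w w' i j} → IsFace G d w → IsFace G d' w' → 0 < d' → d' < d →
                                w i ≡ w' j → w (suc i) ≡ w' (suc j) → ⊥
  shorter-face-shares-no-dart {d' = d'} {w' = w'} {i = i} {j = j} F F' 0<d' d'<d e₀ e₁ =
    proj₂ (proj₂ (proj₂ (face-rotate F i))) d' 0<d' d'<d
      ( trans (proj₁ agree) (trans (face-periodic F' j) (sym e₀))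
      , trans (proj₂ agree) (trans (cong w' (sym (+-suc d' j))) (trans (face-periodic F' (suc j)) (sym e₁))))
    where
    agree = rotation-walks-agree (face-turn F) (face-turn F') e₀ e₁ d'

  face-length-unique : ∀ {d d' w w' i j} → IsFace G d w → IsFace G d' w' → 0 < d → 0 < d' →
                       w i ≡ w' j → w (suc i) ≡ w' (suc j) → d ≡ d'
  face-length-unique {d} {d'} F F' 0<d 0<d' e₀ e₁ with <-cmp d d'
  ... | tri< d<d' _ _ = ⊥-elim (shorter-face-shares-no-dart F' F 0<d d<d' (sym e₀) (sym e₁))
  ... | tri≈ _ d≡d' _ = d≡d'
  ... | tri> _ _ d'<d = ⊥-elim (shorter-face-shares-no-dart F F' 0<d' d'<d e₀ e₁)

  IsFace-cong : ∀ {d w w'} → (∀ k → w k ≡ w' k) → IsFace G d w → IsFace G d w'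
  IsFace-cong {d} {w' = w'} w≗w' (edge , r , (closes₀ , closes₁) , minimal) =
      (λ k → subst₂ _~_ (w≗w' k) (w≗w' (suc k)) (edge k))
    , (λ k → subst₂ (λ x y → rot x y ≡ w' (suc (suc k))) (w≗w' (suc k)) (w≗w' k) (trans (r k) (w≗w' (suc (suc k)))))
    , (trans (sym (w≗w' d)) (trans closes₀ (w≗w' 0)) , trans (sym (w≗w' (suc d))) (trans closes₁ (w≗w' 1)))
    , λ k 0<k k<d (eₖ , eₖ₊₁) → minimal k 0<k k<d
        (trans (w≗w' k) (trans eₖ (sym (w≗w' 0))) , trans (w≗w' (suc k)) (trans eₖ₊₁ (sym (w≗w' 1))))

  face-tabulate : ∀ {d w} → IsFace G (suc d) w → IsFace G (suc d) (walk (tabulate (w ∘ toℕ)))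
  face-tabulate {d} {w} F = IsFace-cong walk≗w F
    where
    walk≗w : ∀ k → w k ≡ walk (tabulate (w ∘ toℕ)) k
    walk≗w k = sym (begin
      walk (tabulate (w ∘ toℕ)) k ≡⟨ lookup∘tabulate (w ∘ toℕ) (k mod suc d) ⟩
      w (toℕ (k mod suc d))       ≡⟨ cong w (toℕ-fromℕ< (m%n<n k (suc d))) ⟩
      w (k % suc d)               ≡⟨ periodic-mod (suc d) (face-periodic F) k ⟨
      w k                         ∎)
      where open ≡-Reasoning

  face-through : ∀ {d w i x y} → IsFace G (suc (suc d)) w → w i ≡ x → w (suc i) ≡ y →
                 Σ (Vec (Fin n) d) λ us → IsFace G (suc (suc d)) (walk (x ∷ y ∷ us))
  face-through {d} {w} {i} F e₀ e₁ =
    rest , subst₂ (λ x y → IsFace G (suc (suc d)) (walk (x ∷ y ∷ rest))) e₀ e₁ (face-tabulate (face-rotate F i))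
    where
    rest : Vec (Fin n) d
    rest = tabulate (λ k → w (suc (suc (toℕ k)) + i))

  face-at : ∀ {d w u} → IsFace G (suc (suc d)) w → OnFace G u w →
            Σ (Vec (Fin n) (suc d)) λ us → IsFace G (suc (suc d)) (walk (u ∷ us))
  face-at F (i , wᵢ≡u) with face-through F wᵢ≡u refl
  ... | rest , F' = _ ∷ rest , F'

module MinDegree3 {n : ℕ} (G : PlaneGraph n) (δ : ∀ u → 3 ≤ deg G u) where
  open PlaneGraph G
  open Embedding G

  rot-no-fixed-point : ∀ {u a} → u ~ a → rot u a ≢ a
  rot-no-fixed-point {u} ua fixed with ≤-trans (δ u) (rot-fixed⇒deg≤1 ua fixed)
  ... | s≤s ()

  rot-not-involutive : ∀ {u a b} → u ~ a → rot u a ≡ b → rot u b ≢ a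
  rot-not-involutive {u} ua a↦b b↦a with ≤-trans (δ u) (rot-involutive⇒deg≤2 ua a↦b b↦a)
  ... | s≤s (s≤s ())

  face-no-backtrack : ∀ {d w} → IsFace G d w → ∀ i → w i ≢ w (suc (suc i))
  face-no-backtrack F i e = rot-no-fixed-point (~-sym (face-edge F i)) (trans (face-turn F i) (sym e))

  module _ {u a b c} (ua : u ~ a) (a↦b : rot u a ≡ b) (b↦c : rot u b ≡ c) where
    private
      ub : u ~ b
      ub = subst (u ~_) a↦b (rot-adj u a ua)
      uc : u ~ c
      uc = subst (u ~_) b↦c (rot-adj u b ub)
      a≢b : a ≢ b
      a≢b a≡b = rot-no-fixed-point ua (trans a↦b (sym a≡b))
      b≢c : b ≢ c
      b≢c b≡c = rot-no-fixed-point ub (trans b↦c (sym b≡c))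
      a≢c : a ≢ c
      a≢c a≡c = rot-not-involutive ua a↦b (trans b↦c (sym a≡c))

    rot-3-cycle : deg G u ≡ 3 → rot u c ≡ a
    rot-3-cycle d≡3 with neighbours-of-deg≡3 d≡3 ua ub uc a≢b a≢c b≢c (rot-adj u c uc)
    ... | inj₁ c↦a = c↦a
    ... | inj₂ (inj₁ c↦b) = ⊥-elim (a≢c (sym (rot-inj u c a uc ua (trans c↦b (sym a↦b)))))
    ... | inj₂ (inj₂ c↦c) = ⊥-elim (rot-no-fixed-point uc c↦c)

    angle-at-deg≡3 : ∀ {p q} → deg G u ≡ 3 → u ~ p → rot u p ≡ q →
                     (p ≡ a × q ≡ b) ⊎ (p ≡ b × q ≡ c) ⊎ (p ≡ c × q ≡ a)
    angle-at-deg≡3 d≡3 up p↦q with neighbours-of-deg≡3 d≡3 ua ub uc a≢b a≢c b≢c up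
    ... | inj₁ refl        = inj₁ (refl , trans (sym p↦q) a↦b)
    ... | inj₂ (inj₁ refl) = inj₂ (inj₁ (refl , trans (sym p↦q) b↦c))
    ... | inj₂ (inj₂ refl) = inj₂ (inj₂ (refl , trans (sym p↦q) (rot-3-cycle d≡3)))

module Configuration {n : ℕ} (G : PlaneGraph n) (no-C4 : ¬ HasCycle G 4) (no-C8 : ¬ HasCycle G 8)
  (δ : ∀ u → 3 ≤ deg G u) (v v₁ v₂ v₃ v₄ v₅ v₆ v₇ v₈ : Fin n) (deg-v : deg G v ≡ 3)
  (f₁ : IsFace G 3 (walk (v ∷ v₁ ∷ v₂ ∷ [])))
  (f₂ : IsFace G 5 (walk (v ∷ v₂ ∷ v₃ ∷ v₄ ∷ v₅ ∷ [])))
  (f₃ : IsFace G 6 (walk (v ∷ v₅ ∷ v₆ ∷ v₇ ∷ v₈ ∷ v₁ ∷ []))) where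

  open PlaneGraph G
  open Embedding G
  open MinDegree3 G δ

  no-square : ∀ {a b c d} → a ~ b → b ~ c → c ~ d → d ~ a → a ≢ c → b ≢ d → ⊥
  no-square ab bc cd da a≢c b≢d = no-C4 (4-cycle ab bc cd da a≢c b≢d)

  v~v₁ : v ~ v₁
  v~v₁ = face-edge f₁ 0
  v₁~v₂ : v₁ ~ v₂
  v₁~v₂ = face-edge f₁ 1
  v₂~v : v₂ ~ v
  v₂~v = face-edge f₁ 2
  v₂~v₃ : v₂ ~ v₃
  v₂~v₃ = face-edge f₂ 1
  v₃~v₄ : v₃ ~ v₄
  v₃~v₄ = face-edge f₂ 2
  v₄~v₅ : v₄ ~ v₅
  v₄~v₅ = face-edge f₂ 3
  v₅~v : v₅ ~ v
  v₅~v = face-edge f₂ 4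
  v₅~v₆ : v₅ ~ v₆
  v₅~v₆ = face-edge f₃ 1
  v₆~v₇ : v₆ ~ v₇
  v₆~v₇ = face-edge f₃ 2
  v₇~v₈ : v₇ ~ v₈
  v₇~v₈ = face-edge f₃ 3
  v₈~v₁ : v₈ ~ v₁
  v₈~v₁ = face-edge f₃ 4

  v↝v₁↝v₂ : v ↝ v₁ ↝ v₂
  v↝v₁↝v₂ = face-turn f₁ 0
  v₁↝v₂↝v : v₁ ↝ v₂ ↝ v
  v₁↝v₂↝v = face-turn f₁ 1
  v₂↝v↝v₁ : v₂ ↝ v ↝ v₁
  v₂↝v↝v₁ = face-turn f₁ 2
  v↝v₂↝v₃ : v ↝ v₂ ↝ v₃
  v↝v₂↝v₃ = face-turn f₂ 0
  v₂↝v₃↝v₄ : v₂ ↝ v₃ ↝ v₄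
  v₂↝v₃↝v₄ = face-turn f₂ 1
  v₄↝v₅↝v : v₄ ↝ v₅ ↝ v
  v₄↝v₅↝v = face-turn f₂ 3
  v↝v₅↝v₆ : v ↝ v₅ ↝ v₆
  v↝v₅↝v₆ = face-turn f₃ 0
  v₈↝v₁↝v : v₈ ↝ v₁ ↝ v
  v₈↝v₁↝v = face-turn f₃ 4

  v≢v₃ : v ≢ v₃
  v≢v₃ = face-no-backtrack f₂ 0
  v₂≢v₄ : v₂ ≢ v₄
  v₂≢v₄ = face-no-backtrack f₂ 1
  v₃≢v₅ : v₃ ≢ v₅
  v₃≢v₅ = face-no-backtrack f₂ 2
  v₄≢v : v₄ ≢ v
  v₄≢v = face-no-backtrack f₂ 3
  v₅≢v₂ : v₅ ≢ v₂
  v₅≢v₂ = face-no-backtrack f₂ 4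
  v≢v₆ : v ≢ v₆
  v≢v₆ = face-no-backtrack f₃ 0
  v₅≢v₇ : v₅ ≢ v₇
  v₅≢v₇ = face-no-backtrack f₃ 1
  v₆≢v₈ : v₆ ≢ v₈
  v₆≢v₈ = face-no-backtrack f₃ 2
  v₇≢v₁ : v₇ ≢ v₁
  v₇≢v₁ = face-no-backtrack f₃ 3
  v₈≢v : v₈ ≢ v
  v₈≢v = face-no-backtrack f₃ 4
  v₁≢v₅ : v₁ ≢ v₅
  v₁≢v₅ = face-no-backtrack f₃ 5

  v≁other : ∀ {y} → y ≢ v₁ → y ≢ v₂ → y ≢ v₅ → ¬ v ~ y
  v≁other y≢v₁ y≢v₂ y≢v₅ vy
    with neighbours-of-deg≡3 deg-v v~v₁ (~-sym v₂~v) (~-sym v₅~v) (~⇒≢ v₁~v₂) v₁≢v₅ (≢-sym v₅≢v₂) vy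
  ... | inj₁ y≡v₁ = y≢v₁ y≡v₁
  ... | inj₂ (inj₁ y≡v₂) = y≢v₂ y≡v₂
  ... | inj₂ (inj₂ y≡v₅) = y≢v₅ y≡v₅

  v≁v₃ : ¬ v ~ v₃
  v≁v₃ v~v₃ = no-square v~v₃ v₃~v₄ v₄~v₅ v₅~v (≢-sym v₄≢v) v₃≢v₅
  v≁v₄ : ¬ v ~ v₄
  v≁v₄ v~v₄ = no-square (~-sym v₂~v) v₂~v₃ v₃~v₄ (~-sym v~v₄) v≢v₃ v₂≢v₄
  v₁≁v₃ : ¬ v₁ ~ v₃
  v₁≁v₃ v₁~v₃ = no-square v~v₁ v₁~v₃ (~-sym v₂~v₃) v₂~v v≢v₃ (~⇒≢ v₁~v₂)
  v₁≁v₄ : ¬ v₁ ~ v₄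
  v₁≁v₄ v₁~v₄ = no-square v~v₁ v₁~v₄ v₄~v₅ v₅~v (≢-sym v₄≢v) v₁≢v₅
  v₁≁v₅ : ¬ v₁ ~ v₅
  v₁≁v₅ v₁~v₅ = no-square (~-sym v₂~v) (~-sym v₁~v₂) v₁~v₅ v₅~v (~⇒≢ v~v₁) (≢-sym v₅≢v₂)
  v₂≁v₄ : ¬ v₂ ~ v₄
  v₂≁v₄ v₂~v₄ = no-square (~-sym v₂~v) v₂~v₄ v₄~v₅ v₅~v (≢-sym v₄≢v) (≢-sym v₅≢v₂)
  v₂≁v₅ : ¬ v₂ ~ v₅
  v₂≁v₅ v₂~v₅ = no-square v₂~v₃ v₃~v₄ v₄~v₅ (~-sym v₂~v₅) v₂≢v₄ v₃≢v₅
  v₃≁v₅ : ¬ v₃ ~ v₅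
  v₃≁v₅ v₃~v₅ = no-square (~-sym v₂~v) v₂~v₃ v₃~v₅ v₅~v v≢v₃ (≢-sym v₅≢v₂)
  v₂≁v₈ : ¬ v₂ ~ v₈
  v₂≁v₈ v₂~v₈ = no-square v~v₁ (~-sym v₈~v₁) (~-sym v₂~v₈) v₂~v (≢-sym v₈≢v) (~⇒≢ v₁~v₂)
  v₂≁v₆ : ¬ v₂ ~ v₆
  v₂≁v₆ v₂~v₆ = no-square (~-sym v₂~v) v₂~v₆ (~-sym v₅~v₆) v₅~v v≢v₆ (≢-sym v₅≢v₂)
  v₅≁v₈ : ¬ v₅ ~ v₈
  v₅≁v₈ v₅~v₈ = no-square v~v₁ (~-sym v₈~v₁) (~-sym v₅~v₈) v₅~v (≢-sym v₈≢v) v₁≢v₅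

  v₁≢v₃ : v₁ ≢ v₃
  v₁≢v₃ = ~∧≁⇒≢ v~v₁ v≁v₃
  v₁≢v₄ : v₁ ≢ v₄
  v₁≢v₄ = ~∧≁⇒≢ v~v₁ v≁v₄
  v₆≢v₁ : v₆ ≢ v₁
  v₆≢v₁ = ~∧≁⇒≢ v₅~v₆ (≁-sym v₁≁v₅)
  v₆≢v₂ : v₆ ≢ v₂
  v₆≢v₂ = ~∧≁⇒≢ v₅~v₆ (≁-sym v₂≁v₅)
  v₆≢v₃ : v₆ ≢ v₃
  v₆≢v₃ = ~∧≁⇒≢ v₅~v₆ (≁-sym v₃≁v₅)
  v₄≢v₆ : v₄ ≢ v₆
  v₄≢v₆ v₄≡v₆ = rot-not-involutive (~-sym v₄~v₅) v₄↝v₅↝v (trans v↝v₅↝v₆ (sym v₄≡v₆))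
  v₈≢v₂ : v₈ ≢ v₂
  v₈≢v₂ v₈≡v₂ = rot-not-involutive (~-sym v~v₁) v↝v₁↝v₂ (subst (λ x → rot v₁ x ≡ v) v₈≡v₂ v₈↝v₁↝v)
  v₃≁v₈ : ¬ v₃ ~ v₈
  v₃≁v₈ v₃~v₈ = no-square v₁~v₂ v₂~v₃ v₃~v₈ v₈~v₁ v₁≢v₃ (≢-sym v₈≢v₂)
  v₃≁v₆ : ¬ v₃ ~ v₆
  v₃≁v₆ v₃~v₆ = no-square v₃~v₆ (~-sym v₅~v₆) (~-sym v₄~v₅) (~-sym v₃~v₄) v₃≢v₅ (≢-sym v₄≢v₆)
  v₈≢v₃ : v₈ ≢ v₃
  v₈≢v₃ = ~∧≁⇒≢ (~-sym v₈~v₁) v₁≁v₃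
  v₈≢v₄ : v₈ ≢ v₄
  v₈≢v₄ = ~∧≁⇒≢ (~-sym v₈~v₁) v₁≁v₄
  v₈≢v₅ : v₈ ≢ v₅
  v₈≢v₅ = ~∧≁⇒≢ (~-sym v₈~v₁) v₁≁v₅
  v₇≢v₂ : v₇ ≢ v₂
  v₇≢v₂ = ~∧≁⇒≢ (~-sym v₇~v₈) (≁-sym v₂≁v₈)
  v₇≢v₃ : v₇ ≢ v₃
  v₇≢v₃ = ~∧≁⇒≢ (~-sym v₇~v₈) (≁-sym v₃≁v₈)
  v≁v₆ : ¬ v ~ v₆
  v≁v₆ = v≁other v₆≢v₁ v₆≢v₂ (≢-sym (~⇒≢ v₅~v₆))
  v≁v₈ : ¬ v ~ v₈
  v≁v₈ = v≁other (~⇒≢ v₈~v₁) v₈≢v₂ v₈≢v₅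

  v₇≡v₄ : v₇ ≡ v₄
  v₇≡v₄ with v₇ ≟ v₄
  ... | yes v₇≡v₄ = v₇≡v₄
  ... | no v₇≢v₄ = ⊥-elim (no-C8 (8-cycle v₁~v₂ v₂~v₃ v₃~v₄ v₄~v₅ v₅~v₆ v₆~v₇ v₇~v₈ v₈~v₁
      ( (~⇒≢ v₁~v₂ ∷ v₁≢v₃ ∷ v₁≢v₄ ∷ v₁≢v₅ ∷ ≢-sym v₆≢v₁ ∷ ≢-sym v₇≢v₁ ∷ ≢-sym (~⇒≢ v₈~v₁) ∷ [])
      ∷ (~⇒≢ v₂~v₃ ∷ v₂≢v₄ ∷ ≢-sym v₅≢v₂ ∷ ≢-sym v₆≢v₂ ∷ ≢-sym v₇≢v₂ ∷ ≢-sym v₈≢v₂ ∷ [])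
      ∷ (~⇒≢ v₃~v₄ ∷ v₃≢v₅ ∷ ≢-sym v₆≢v₃ ∷ ≢-sym v₇≢v₃ ∷ ≢-sym v₈≢v₃ ∷ [])
      ∷ (~⇒≢ v₄~v₅ ∷ v₄≢v₆ ∷ ≢-sym v₇≢v₄ ∷ ≢-sym v₈≢v₄ ∷ [])
      ∷ (~⇒≢ v₅~v₆ ∷ v₅≢v₇ ∷ ≢-sym v₈≢v₅ ∷ [])
      ∷ (~⇒≢ v₆~v₇ ∷ v₆≢v₈ ∷ [])
      ∷ (~⇒≢ v₇~v₈ ∷ [])
      ∷ [] ∷ [])))

module Collapsed {n : ℕ} (G : PlaneGraph n) (no-C4 : ¬ HasCycle G 4) (no-C8 : ¬ HasCycle G 8)
  (δ : ∀ u → 3 ≤ deg G u) (v v₁ v₂ v₃ v₄ v₅ v₆ v₈ : Fin n) (deg-v : deg G v ≡ 3)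
  (f₁ : IsFace G 3 (walk (v ∷ v₁ ∷ v₂ ∷ [])))
  (f₂ : IsFace G 5 (walk (v ∷ v₂ ∷ v₃ ∷ v₄ ∷ v₅ ∷ [])))
  (f₃ : IsFace G 6 (walk (v ∷ v₅ ∷ v₆ ∷ v₄ ∷ v₈ ∷ v₁ ∷ []))) where

  open PlaneGraph G
  open Embedding G
  open MinDegree3 G δ
  open Configuration G no-C4 no-C8 δ v v₁ v₂ v₃ v₄ v₅ v₆ v₄ v₈ deg-v f₁ f₂ f₃
    hiding (v₅≢v₇; v₇≢v₁; v₇≢v₂; v₇≢v₃; v₇≡v₄)
    renaming (v₆~v₇ to v₆~v₄; v₇~v₈ to v₄~v₈)

  v₅↝v₆↝v₄ : v₅ ↝ v₆ ↝ v₄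
  v₅↝v₆↝v₄ = face-turn f₃ 1
  v₄↝v₈↝v₁ : v₄ ↝ v₈ ↝ v₁
  v₄↝v₈↝v₁ = face-turn f₃ 3

  v₆≁v₈ : ¬ v₆ ~ v₈
  v₆≁v₈ v₆~v₈ = no-square v₆~v₈ (~-sym v₄~v₈) v₄~v₅ v₅~v₆ (≢-sym v₄≢v₆) v₈≢v₅

  no-common-neighbour-v₃v₂ : NoCommonNeighbour v₃ v₂
  no-common-neighbour-v₃v₂ x~v₃ x~v₂ = no-C8 (8-cycle
    x~v₃ v₃~v₄ (~-sym v₆~v₄) (~-sym v₅~v₆) v₅~v v~v₁ v₁~v₂ (~-sym x~v₂)
    ( (~⇒≢ x~v₃ ∷ ~∧≁⇒≢ (~-sym x~v₂) v₂≁v₄ ∷ ~∧≁⇒≢ (~-sym x~v₃) v₃≁v₆ ∷ ~∧≁⇒≢ (~-sym x~v₃) v₃≁v₅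
        ∷ ~∧≁⇒≢ (~-sym x~v₃) (≁-sym v≁v₃) ∷ ~∧≁⇒≢ (~-sym x~v₃) (≁-sym v₁≁v₃) ∷ ~⇒≢ x~v₂ ∷ [])
    ∷ (~⇒≢ v₃~v₄ ∷ ≢-sym v₆≢v₃ ∷ v₃≢v₅ ∷ ≢-sym v≢v₃ ∷ ≢-sym v₁≢v₃ ∷ ≢-sym (~⇒≢ v₂~v₃) ∷ [])
    ∷ (v₄≢v₆ ∷ ~⇒≢ v₄~v₅ ∷ v₄≢v ∷ ≢-sym v₁≢v₄ ∷ ≢-sym v₂≢v₄ ∷ [])
    ∷ (≢-sym (~⇒≢ v₅~v₆) ∷ ≢-sym v≢v₆ ∷ v₆≢v₁ ∷ v₆≢v₂ ∷ [])
    ∷ (~⇒≢ v₅~v ∷ ≢-sym v₁≢v₅ ∷ v₅≢v₂ ∷ [])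
    ∷ (~⇒≢ v~v₁ ∷ ≢-sym (~⇒≢ v₂~v) ∷ [])
    ∷ (~⇒≢ v₁~v₂ ∷ [])
    ∷ [] ∷ []))

  no-common-neighbour-v₃v₄ : NoCommonNeighbour v₃ v₄
  no-common-neighbour-v₃v₄ x~v₃ x~v₄ = no-C8 (8-cycle
    x~v₄ (~-sym v₆~v₄) (~-sym v₅~v₆) v₅~v v~v₁ v₁~v₂ v₂~v₃ (~-sym x~v₃)
    ( (~⇒≢ x~v₄ ∷ ~∧≁⇒≢ (~-sym x~v₃) v₃≁v₆ ∷ ~∧≁⇒≢ (~-sym x~v₃) v₃≁v₅ ∷ ~∧≁⇒≢ (~-sym x~v₃) (≁-sym v≁v₃)
        ∷ ~∧≁⇒≢ (~-sym x~v₃) (≁-sym v₁≁v₃) ∷ ~∧≁⇒≢ (~-sym x~v₄) (≁-sym v₂≁v₄) ∷ ~⇒≢ x~v₃ ∷ [])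
    ∷ (v₄≢v₆ ∷ ~⇒≢ v₄~v₅ ∷ v₄≢v ∷ ≢-sym v₁≢v₄ ∷ ≢-sym v₂≢v₄ ∷ ≢-sym (~⇒≢ v₃~v₄) ∷ [])
    ∷ (≢-sym (~⇒≢ v₅~v₆) ∷ ≢-sym v≢v₆ ∷ v₆≢v₁ ∷ v₆≢v₂ ∷ v₆≢v₃ ∷ [])
    ∷ (~⇒≢ v₅~v ∷ ≢-sym v₁≢v₅ ∷ v₅≢v₂ ∷ ≢-sym v₃≢v₅ ∷ [])
    ∷ (~⇒≢ v~v₁ ∷ ≢-sym (~⇒≢ v₂~v) ∷ v≢v₃ ∷ [])
    ∷ (~⇒≢ v₁~v₂ ∷ v₁≢v₃ ∷ [])
    ∷ (~⇒≢ v₂~v₃ ∷ [])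
    ∷ [] ∷ []))

  no-common-neighbour-v₈v₁ : NoCommonNeighbour v₈ v₁
  no-common-neighbour-v₈v₁ x~v₈ x~v₁ = no-C8 (8-cycle
    x~v₁ v₁~v₂ v₂~v (~-sym v₅~v) v₅~v₆ v₆~v₄ v₄~v₈ (~-sym x~v₈)
    ( (~⇒≢ x~v₁ ∷ ~∧≁⇒≢ (~-sym x~v₈) (≁-sym v₂≁v₈) ∷ ~∧≁⇒≢ (~-sym x~v₈) (≁-sym v≁v₈)
        ∷ ~∧≁⇒≢ (~-sym x~v₈) (≁-sym v₅≁v₈) ∷ ~∧≁⇒≢ (~-sym x~v₈) (≁-sym v₆≁v₈)
        ∷ ~∧≁⇒≢ (~-sym x~v₁) v₁≁v₄ ∷ ~⇒≢ x~v₈ ∷ [])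
    ∷ (~⇒≢ v₁~v₂ ∷ ≢-sym (~⇒≢ v~v₁) ∷ v₁≢v₅ ∷ ≢-sym v₆≢v₁ ∷ v₁≢v₄ ∷ ≢-sym (~⇒≢ v₈~v₁) ∷ [])
    ∷ (~⇒≢ v₂~v ∷ ≢-sym v₅≢v₂ ∷ ≢-sym v₆≢v₂ ∷ v₂≢v₄ ∷ ≢-sym v₈≢v₂ ∷ [])
    ∷ (≢-sym (~⇒≢ v₅~v) ∷ v≢v₆ ∷ ≢-sym v₄≢v ∷ ≢-sym v₈≢v ∷ [])
    ∷ (~⇒≢ v₅~v₆ ∷ ≢-sym (~⇒≢ v₄~v₅) ∷ ≢-sym v₈≢v₅ ∷ [])
    ∷ (~⇒≢ v₆~v₄ ∷ v₆≢v₈ ∷ [])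
    ∷ (~⇒≢ v₄~v₈ ∷ [])
    ∷ [] ∷ []))

  no-common-neighbour-v₈v₄ : NoCommonNeighbour v₈ v₄
  no-common-neighbour-v₈v₄ x~v₈ x~v₄ = no-C8 (8-cycle
    x~v₄ (~-sym v₆~v₄) (~-sym v₅~v₆) v₅~v (~-sym v₂~v) (~-sym v₁~v₂) (~-sym v₈~v₁) (~-sym x~v₈)
    ( (~⇒≢ x~v₄ ∷ ~∧≁⇒≢ (~-sym x~v₈) (≁-sym v₆≁v₈) ∷ ~∧≁⇒≢ (~-sym x~v₈) (≁-sym v₅≁v₈)
        ∷ ~∧≁⇒≢ (~-sym x~v₈) (≁-sym v≁v₈) ∷ ~∧≁⇒≢ (~-sym x~v₈) (≁-sym v₂≁v₈)
        ∷ ~∧≁⇒≢ (~-sym x~v₄) (≁-sym v₁≁v₄) ∷ ~⇒≢ x~v₈ ∷ [])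
    ∷ (v₄≢v₆ ∷ ~⇒≢ v₄~v₅ ∷ v₄≢v ∷ ≢-sym v₂≢v₄ ∷ ≢-sym v₁≢v₄ ∷ ≢-sym v₈≢v₄ ∷ [])
    ∷ (≢-sym (~⇒≢ v₅~v₆) ∷ ≢-sym v≢v₆ ∷ v₆≢v₂ ∷ v₆≢v₁ ∷ v₆≢v₈ ∷ [])
    ∷ (~⇒≢ v₅~v ∷ v₅≢v₂ ∷ ≢-sym v₁≢v₅ ∷ ≢-sym v₈≢v₅ ∷ [])
    ∷ (≢-sym (~⇒≢ v₂~v) ∷ ~⇒≢ v~v₁ ∷ ≢-sym v₈≢v ∷ [])
    ∷ (≢-sym (~⇒≢ v₁~v₂) ∷ ≢-sym v₈≢v₂ ∷ [])
    ∷ (≢-sym (~⇒≢ v₈~v₁) ∷ [])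
    ∷ [] ∷ []))

  no-pentagon-at-v₁v₈ : ∀ {a b} → ¬ IsFace G 5 (walk (v₁ ∷ v₈ ∷ a ∷ b ∷ v₂ ∷ []))
  no-pentagon-at-v₁v₈ {a} {b} P = no-C8 (8-cycle
    (~-sym b~v₂) (~-sym a~b) (~-sym v₈~a) (~-sym v₄~v₈) (~-sym v₆~v₄) (~-sym v₅~v₆) v₅~v (~-sym v₂~v)
    ( (≢-sym (~⇒≢ b~v₂) ∷ ≢-sym a≢v₂ ∷ ≢-sym v₈≢v₂ ∷ v₂≢v₄ ∷ ≢-sym v₆≢v₂ ∷ ≢-sym v₅≢v₂ ∷ ~⇒≢ v₂~v ∷ [])
    ∷ (≢-sym (~⇒≢ a~b) ∷ ≢-sym v₈≢b ∷ ~∧≁⇒≢ (~-sym b~v₂) v₂≁v₄ ∷ ~∧≁⇒≢ (~-sym b~v₂) v₂≁v₆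
        ∷ ~∧≁⇒≢ (~-sym b~v₂) v₂≁v₅ ∷ ~∧≁⇒≢ a~b (≁-sym (v≁other a≢v₁ a≢v₂ a≢v₅)) ∷ [])
    ∷ (≢-sym (~⇒≢ v₈~a) ∷ a≢v₄ ∷ ~∧≁⇒≢ v₈~a (≁-sym v₆≁v₈) ∷ a≢v₅ ∷ ~∧≁⇒≢ v₈~a (≁-sym v≁v₈) ∷ [])
    ∷ (v₈≢v₄ ∷ ≢-sym v₆≢v₈ ∷ v₈≢v₅ ∷ v₈≢v ∷ [])
    ∷ (v₄≢v₆ ∷ ~⇒≢ v₄~v₅ ∷ v₄≢v ∷ [])
    ∷ (≢-sym (~⇒≢ v₅~v₆) ∷ ≢-sym v≢v₆ ∷ [])
    ∷ (~⇒≢ v₅~v ∷ [])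
    ∷ [] ∷ []))
    where
    v₈~a : v₈ ~ a
    v₈~a = face-edge P 1
    a~b : a ~ b
    a~b = face-edge P 2
    b~v₂ : b ~ v₂
    b~v₂ = face-edge P 3
    a≢v₁ : a ≢ v₁
    a≢v₁ = ≢-sym (face-no-backtrack P 0)
    v₈≢b : v₈ ≢ b
    v₈≢b = face-no-backtrack P 1
    a≢v₂ : a ≢ v₂
    a≢v₂ = face-no-backtrack P 2
    a≢v₄ : a ≢ v₄
    a≢v₄ a≡v₄ = rot-not-involutive (~-sym v₄~v₈) v₄↝v₈↝v₁ (trans (face-turn P 0) a≡v₄)
    a≢v₅ : a ≢ v₅
    a≢v₅ = ~∧≁⇒≢ v₈~a (≁-sym v₅≁v₈)

  no-hexagon-at-v₂v₁ : ∀ {a b c} → ¬ IsFace G 6 (walk (v₂ ∷ v₁ ∷ a ∷ b ∷ c ∷ v₃ ∷ []))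
  no-hexagon-at-v₂v₁ {a} {b} {c} H = no-C8 (8-cycle
    v₁~a a~b b~c c~v₃ v₃~v₄ v₄~v₅ v₅~v v~v₁
    ( (~⇒≢ v₁~a ∷ face-no-backtrack H 1 ∷ ≢-sym (~∧≁⇒≢ (~-sym c~v₃) (≁-sym v₁≁v₃)) ∷ v₁≢v₃ ∷ v₁≢v₄ ∷ v₁≢v₅
        ∷ ≢-sym (~⇒≢ v~v₁) ∷ [])
    ∷ (~⇒≢ a~b ∷ face-no-backtrack H 2 ∷ ~∧≁⇒≢ v₁~a v₁≁v₃ ∷ ~∧≁⇒≢ v₁~a v₁≁v₄ ∷ a≢v₅ ∷ a≢v ∷ [])
    ∷ (~⇒≢ b~c ∷ face-no-backtrack H 3 ∷ b≢v₄ ∷ b≢v₅ ∷ ~∧≁⇒≢ a~b (≁-sym (v≁other a≢v₁ a≢v₂ a≢v₅)) ∷ [])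
    ∷ (~⇒≢ c~v₃ ∷ c≢v₄ ∷ ~∧≁⇒≢ (~-sym c~v₃) v₃≁v₅ ∷ ~∧≁⇒≢ (~-sym c~v₃) (≁-sym v≁v₃) ∷ [])
    ∷ (~⇒≢ v₃~v₄ ∷ v₃≢v₅ ∷ ≢-sym v≢v₃ ∷ [])
    ∷ (~⇒≢ v₄~v₅ ∷ v₄≢v ∷ [])
    ∷ (~⇒≢ v₅~v ∷ [])
    ∷ [] ∷ []))
    where
    v₁~a : v₁ ~ a
    v₁~a = face-edge H 1
    a~b : a ~ b
    a~b = face-edge H 2
    b~c : b ~ c
    b~c = face-edge H 3
    c~v₃ : c ~ v₃
    c~v₃ = face-edge H 4
    a≢v₁ : a ≢ v₁
    a≢v₁ = ≢-sym (~⇒≢ v₁~a)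
    a≢v₂ : a ≢ v₂
    a≢v₂ = ≢-sym (face-no-backtrack H 0)
    a≢v₅ : a ≢ v₅
    a≢v₅ = ~∧≁⇒≢ v₁~a v₁≁v₅
    a≢v : a ≢ v
    a≢v a≡v = rot-not-involutive (~-sym v~v₁) v↝v₁↝v₂ (trans (face-turn H 0) a≡v)
    c≢v₄ : c ≢ v₄
    c≢v₄ c≡v₄ = rot-not-involutive (~-sym v₂~v₃) v₂↝v₃↝v₄ (subst (λ x → rot v₃ x ≡ v₂) c≡v₄ (face-turn H 4))
    b≢v₅ : b ≢ v₅
    b≢v₅ refl = no-square (~-sym c~v₃) (~-sym b~c) (~-sym v₄~v₅) (~-sym v₃~v₄) v₃≢v₅ c≢v₄
    b≢v₄ : b ≢ v₄
    b≢v₄ refl with a ≟ v₈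
    ... | yes refl = rot-not-involutive (~-sym v₄~v₈) v₄↝v₈↝v₁ (face-turn H 1)
    ... | no a≢v₈ = no-square v₁~a a~b v₄~v₈ v₈~v₁ v₁≢v₄ a≢v₈

  v₁-not-special : ¬ Special G v₁
  v₁-not-special (deg≡3 , _ , (_ , F , on) , _) with face-at F on
  ... | q ∷ a ∷ b ∷ p ∷ [] , P
    with angle-at-deg≡3 (~-sym v₈~v₁) v₈↝v₁↝v v↝v₁↝v₂ deg≡3 (~-sym (face-edge P 4)) (face-turn P 4)
  ... | inj₁ (refl , refl) with () ← face-length-unique {i = 0} {j = 5} P f₃ (s≤s z≤n) (s≤s z≤n) refl refl
  ... | inj₂ (inj₁ (refl , refl)) with () ← face-length-unique {i = 0} {j = 1} P f₁ (s≤s z≤n) (s≤s z≤n) refl refl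
  ... | inj₂ (inj₂ (refl , refl)) = no-pentagon-at-v₁v₈ P

  v₂-not-special : ¬ Special G v₂
  v₂-not-special (deg≡3 , _ , _ , (_ , F , on)) with face-at F on
  ... | q ∷ a ∷ b ∷ c ∷ p ∷ [] , H
    with angle-at-deg≡3 (~-sym v₁~v₂) v₁↝v₂↝v v↝v₂↝v₃ deg≡3 (~-sym (face-edge H 5)) (face-turn H 5)
  ... | inj₁ (refl , refl) with () ← face-length-unique {i = 0} {j = 2} H f₁ (s≤s z≤n) (s≤s z≤n) refl refl
  ... | inj₂ (inj₁ (refl , refl)) with () ← face-length-unique {i = 0} {j = 1} H f₂ (s≤s z≤n) (s≤s z≤n) refl refl
  ... | inj₂ (inj₂ (refl , refl)) = no-hexagon-at-v₂v₁ H

  v₃-not-special : ¬ Special G v₃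
  v₃-not-special (deg≡3 , (_ , F , on) , _) with face-at F on
  ... | q ∷ p ∷ [] , T = deg≡3-triangle-free deg≡3 (~-sym v₂~v₃) v₃~v₄ v₂≢v₄
    no-common-neighbour-v₃v₂ no-common-neighbour-v₃v₄
    (face-edge T 0) (~-sym (face-edge T 2)) (face-edge T 1)

  v₄-not-special : ¬ Special G v₄
  v₄-not-special (deg≡3 , _) = deg≡3⇒4≰deg deg≡3 (4≤deg (~-sym v₃~v₄) v₄~v₅ (~-sym v₆~v₄) v₄~v₈
    ( (v₃≢v₅ ∷ ≢-sym v₆≢v₃ ∷ ≢-sym v₈≢v₃ ∷ []) ∷ (~⇒≢ v₅~v₆ ∷ ≢-sym v₈≢v₅ ∷ []) ∷ (v₆≢v₈ ∷ []) ∷ [] ∷ []))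

  v₅-not-special : ¬ Special G v₅
  v₅-not-special (deg≡3 , (_ , F , on) , _) with face-at F on
  ... | q ∷ p ∷ [] , T
    with angle-at-deg≡3 (~-sym v₄~v₅) v₄↝v₅↝v v↝v₅↝v₆ deg≡3 (~-sym (face-edge T 2)) (face-turn T 2)
  ... | inj₁ (refl , refl) = v≁v₄ (face-edge T 1)
  ... | inj₂ (inj₁ (refl , refl)) = v≁v₆ (~-sym (face-edge T 1))
  ... | inj₂ (inj₂ (refl , refl)) = rot-not-involutive (~-sym v₅~v₆) v₅↝v₆↝v₄ (face-turn T 1)

  v₆-not-special : ¬ Special G v₆
  v₆-not-special (deg≡3 , (_ , F , on) , _) with face-at F on
  ... | q ∷ p ∷ [] , T
    with angle-at-deg≡3 (~-sym v₅~v₆) v₅↝v₆↝v₄ refl deg≡3 (~-sym (face-edge T 2)) (face-turn T 2)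
  ... | inj₁ (refl , refl) with () ← face-length-unique {i = 1} {j = 3} T f₂ (s≤s z≤n) (s≤s z≤n) refl refl
  ... | inj₂ (inj₁ (refl , refl)) = no-square (face-edge T 1) v₄~v₅ v₅~v₆ (face-edge T 0)
                                      (rot-not-involutive (~-sym v₅~v₆) v₅↝v₆↝v₄) (v₄≢v₆)
  ... | inj₂ (inj₂ (refl , refl)) = no-square (~-sym (face-edge T 1)) (~-sym v₄~v₅) (~-sym v₆~v₄) (~-sym (face-edge T 2))
                                      (rot-no-fixed-point v₆~v₄) (~⇒≢ v₅~v₆)

  v₈-not-special : ¬ Special G v₈
  v₈-not-special (deg≡3 , (_ , F , on) , _) with face-at F on
  ... | q ∷ p ∷ [] , T = deg≡3-triangle-free deg≡3 v₈~v₁ (~-sym v₄~v₈) v₁≢v₄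
    no-common-neighbour-v₈v₁ no-common-neighbour-v₈v₄
    (face-edge T 0) (~-sym (face-edge T 2)) (face-edge T 1)

  f₂-meets-only-f₁ : ∀ w → IsFace G 3 w → FacesAdjacent G w (walk (v ∷ v₂ ∷ v₃ ∷ v₄ ∷ v₅ ∷ [])) →
                     SameFace G w (walk (v ∷ v₁ ∷ v₂ ∷ []))
  f₂-meets-only-f₁ w T (i , j , inj₁ (e₀ , e₁)) with () ← face-length-unique {i = i} {j = j} T f₂ (s≤s z≤n) (s≤s z≤n) e₀ e₁
  f₂-meets-only-f₁ w T (i , j , inj₂ (e₀ , e₁)) = walk-edges (v ∷ v₂ ∷ v₃ ∷ v₄ ∷ v₅ ∷ []) Reversed reversed j e₀ e₁
    where
    Reversed : Fin n → Fin n → Set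
    Reversed x y = w i ≡ y → w (suc i) ≡ x → SameFace G w (walk (v ∷ v₁ ∷ v₂ ∷ []))
    reversed : ∀ k → k < 5 → Reversed (walk (v ∷ v₂ ∷ v₃ ∷ v₄ ∷ v₅ ∷ []) k) (walk (v ∷ v₂ ∷ v₃ ∷ v₄ ∷ v₅ ∷ []) (suc k))
    reversed 0 _ e₀ e₁ = suc i , e₁ , trans (sym (face-turn T i)) (trans (cong₂ rot e₁ e₀) v₂↝v↝v₁)
    reversed 1 _ e₀ e₁ with face-through T e₀ e₁
    ... | z ∷ [] , T' = ⊥-elim (no-common-neighbour-v₃v₂ (face-edge T' 2) (~-sym (face-edge T' 1)))
    reversed 2 _ e₀ e₁ with face-through T e₀ e₁
    ... | z ∷ [] , T' = ⊥-elim (no-common-neighbour-v₃v₄ (~-sym (face-edge T' 1)) (face-edge T' 2))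
    reversed 3 _ e₀ e₁ with face-through T e₀ e₁
    ... | z ∷ [] , T' with z ≟ v₆
    ...   | yes refl = ⊥-elim (rot-not-involutive (~-sym v₅~v₆) v₅↝v₆↝v₄ (face-turn T' 1))
    ...   | no z≢v₆ = ⊥-elim (no-square (~-sym (face-edge T' 1)) (~-sym v₆~v₄) (~-sym v₅~v₆) (~-sym (face-edge T' 2))
                                 z≢v₆ (~⇒≢ v₄~v₅))
    reversed 4 _ e₀ e₁ with face-through T e₀ e₁
    ... | z ∷ [] , T' = ⊥-elim (v≁v₆ (subst (v ~_) (trans (sym (face-turn T' 0)) v↝v₅↝v₆) (~-sym (face-edge T' 2))))
    reversed (suc (suc (suc (suc (suc _))))) (s≤s (s≤s (s≤s (s≤s (s≤s ())))))

  not-special : ∀ u → OnFace G u (walk (v ∷ v₂ ∷ v₃ ∷ v₄ ∷ v₅ ∷ [])) ⊎ OnFace G u (walk (v ∷ v₅ ∷ v₆ ∷ v₄ ∷ v₈ ∷ v₁ ∷ [])) →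
                u ≢ v → ¬ Special G u
  not-special u (inj₁ (i , e)) u≢v with subst (_∈ _) e (walk-∈ (v ∷ v₂ ∷ v₃ ∷ v₄ ∷ v₅ ∷ []) i)
  ... | here refl = ⊥-elim (u≢v refl)
  ... | there (here refl) = v₂-not-special
  ... | there (there (here refl)) = v₃-not-special
  ... | there (there (there (here refl))) = v₄-not-special
  ... | there (there (there (there (here refl)))) = v₅-not-special
  not-special u (inj₂ (i , e)) u≢v with subst (_∈ _) e (walk-∈ (v ∷ v₅ ∷ v₆ ∷ v₄ ∷ v₈ ∷ v₁ ∷ []) i)
  ... | here refl = ⊥-elim (u≢v refl)
  ... | there (here refl) = v₅-not-special
  ... | there (there (here refl)) = v₆-not-special
  ... | there (there (there (here refl))) = v₄-not-special
  ... | there (there (there (there (here refl)))) = v₈-not-special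
  ... | there (there (there (there (there (here refl))))) = v₁-not-special

lemma8 : ∀ {n : ℕ} (G : PlaneGraph n) →
    ¬ HasCycle G 4 → ¬ HasCycle G 8 → (∀ u → 3 ≤ deg G u) →
    ∀ (v v₁ v₂ v₃ v₄ v₅ v₆ v₇ v₈ : Fin n) →
    deg G v ≡ 3 →
    IsFace G 3 (walk (v ∷ v₁ ∷ v₂ ∷ [])) →
    IsFace G 5 (walk (v ∷ v₂ ∷ v₃ ∷ v₄ ∷ v₅ ∷ [])) →
    IsFace G 6 (walk (v ∷ v₅ ∷ v₆ ∷ v₇ ∷ v₈ ∷ v₁ ∷ [])) →
    (v₄ ≡ v₇ ×
     FacesAdjacent G (walk (v ∷ v₁ ∷ v₂ ∷ [])) (walk (v ∷ v₂ ∷ v₃ ∷ v₄ ∷ v₅ ∷ [])) ×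
     (∀ w → IsFace G 3 w →
        FacesAdjacent G w (walk (v ∷ v₂ ∷ v₃ ∷ v₄ ∷ v₅ ∷ [])) →
        SameFace G w (walk (v ∷ v₁ ∷ v₂ ∷ [])))) ×
    (∀ u →
      (OnFace G u (walk (v ∷ v₂ ∷ v₃ ∷ v₄ ∷ v₅ ∷ [])) ⊎
       OnFace G u (walk (v ∷ v₅ ∷ v₆ ∷ v₇ ∷ v₈ ∷ v₁ ∷ []))) →
      u ≢ v → ¬ Special G u)
lemma8 G no-C4 no-C8 δ v v₁ v₂ v₃ v₄ v₅ v₆ v₇ v₈ deg-v f₁ f₂ f₃
  with refl ← Configuration.v₇≡v₄ G no-C4 no-C8 δ v v₁ v₂ v₃ v₄ v₅ v₆ v₇ v₈ deg-v f₁ f₂ f₃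
  = (refl , (2 , 0 , inj₂ (refl , refl)) , f₂-meets-only-f₁) , not-special
  where open Collapsed G no-C4 no-C8 δ v v₁ v₂ v₃ v₄ v₅ v₆ v₈ deg-v f₁ f₂ f₃
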